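{- Let $P=(X,\prec)$ be a finite poset. For every $x\in X$ and all integers $t>a>1$, $$\Omega(P,t;x,a+1)\cdot\Omega(P,t;x,a)\ \ge\ \Omega(P,t+1;x,a+1)\cdot\Omega(P,t-1;x,a).$$
   Context: For an integer $t\ge1$ and integer $a$, $\Omega(P,t;x,a)$ is the number of maps $g:X\to[t]$ with $g(u)\le g(v)$ whenever $u\prec v$, and $g(x)=a$. -}

module Defs where

open import Level using (0ℓ)
open import Data.Nat using (ℕ; zero; suc; _+_; _≟_)
open import Data.Fin using (Fin; toℕ) renaming (_≤_ to _≤ᶠ_; _≤?_ to _≤?ᶠ_)
open import Data.Fin.Properties using (all?)
open import Data.List using (List; []; _∷_; concatMap; map; filter; length; allFin)
open import Relation.Binary.PropositionalEquality using (_≡_)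
open import Relation.Nullary using (Dec; ¬_)
open import Relation.Nullary.Decidable using (_×-dec_; _→-dec_)
open import Data.Product using (_×_)

record FinPoset (n : ℕ) : Set₁ where
  field
    _≺_      : Fin n → Fin n → Set
    ≺-dec    : ∀ u v → Dec (u ≺ v)
    ≺-irrefl : ∀ u → ¬ (u ≺ u)
    ≺-trans  : ∀ {u v w} → u ≺ v → v ≺ w → u ≺ w

-- All maps Fin n → Fin t (every such function appears exactly once,
-- up to pointwise equality).
allMaps : (n t : ℕ) → List (Fin n → Fin t)
allMaps zero    t = (λ ()) ∷ []
allMaps (suc n) t =
  concatMap (λ v → map (λ f → λ { Fin.zero → v ; (Fin.suc i) → f i }) (allMaps n t))
            (allFin t)

-- A map g : X → [t] is encoded as g : Fin n → Fin t, with g(u) ∈ [t] = {1,…,t}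
-- being  toℕ (g u) + 1.
-- Order-preserving: g(u) ≤ g(v) whenever u ≺ v.
OrderPreserving : ∀ {n t} → FinPoset n → (Fin n → Fin t) → Set
OrderPreserving P g = ∀ u v → u ≺ v → g u ≤ᶠ g v
  where open FinPoset P

orderPreserving? : ∀ {n t} (P : FinPoset n) (g : Fin n → Fin t) → Dec (OrderPreserving P g)
orderPreserving? P g =
  all? (λ u → all? (λ v → ≺-dec u v →-dec (g u ≤?ᶠ g v)))
  where open FinPoset P

Ω : ∀ {n} → FinPoset n → (t : ℕ) → Fin n → (a : ℕ) → ℕ
Ω P t x a =
  length (filter (λ g → orderPreserving? P g ×-dec (suc (toℕ (g x)) ≟ a)) (allMaps _ t))

{-# OPTIONS --safe #-}
module Submission where

-- Realise all four counts by order-preserving maps X → [t+1] taking the value a+1 at x: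
-- Ω(P,t+1;x,a+1) counts all of them, Ω(P,t;x,a+1) those avoiding the top value,
-- Ω(P,t;x,a) (shifted up by one) those avoiding the bottom value, and
-- Ω(P,t−1;x,a) those avoiding both.  Pointwise minima and maxima of two such maps are again
-- such maps; the minimum inherits avoidance of the top from either argument and the maximum
-- avoidance of the bottom.  So the Ahlswede–Daykin four functions theorem on the distributive
-- lattice [t+1]^X gives the inequality.  That theorem is proved by induction on |X|, each step
-- being its case for a chain, which in turn reduces to the two-element lattice.

open import Defs
open import Data.Nat using (ℕ; zero; suc; _+_; _*_; _≤_; _<_; _≥_; _∸_; z≤n; s≤s; _≟_)
open import Data.Nat.Properties
  using (m≤n⇒∃[o]m+o≡n; +-mono-≤; +-monoʳ-≤; *-mono-≤; *-monoʳ-≤; *-cancelˡ-≤; *-distribˡ-+;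
         +-identityʳ; suc-injective; ≤-refl; +-*-semiring; module ≤-Reasoning)
open import Data.Nat.Solver using (module +-*-Solver)
open import Data.Nat.ListAction using () renaming (sum to sumᴸ)
open import Data.Nat.ListAction.Properties using (sum-++)
open import Data.Fin using (Fin; punchIn; fromℕ; toℕ) renaming (_≤_ to _≤ᶠ_)
import Data.Fin as Fin
open import Data.Fin.Properties
  using (all?; punchInᵢ≢i; punchIn-mono-≤; punchIn-cancel-≤; toℕ-injective; ≤fromℕ)
  renaming (≤-totalOrder to ≤ᶠ-totalOrder; ≤-antisym to ≤ᶠ-antisym; _≟_ to _≟ᶠ_;
            suc-injective to sucᶠ-injective)
open import Data.Vec.Functional using ([]; _∷_)
open import Data.List using (List; _++_; map; concatMap; tabulate; allFin; length; filter)
import Data.List as List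
open import Data.List.Properties using (map-++; map-∘; map-cong; map-tabulate)
open import Data.Product using (_×_; _,_; proj₁; proj₂)
open import Data.Product.Function.NonDependent.Propositional using (_×-⇔_)
open import Function using (_∘_; _⇔_; mk⇔; Equivalence)
open import Relation.Nullary using (Dec; yes; no; ¬_; ¬?; contradiction)
open import Relation.Nullary.Decidable using (_×-dec_)
open import Relation.Unary using (Decidable)
open import Relation.Binary.PropositionalEquality
open import Algebra.Properties.Semiring.Sum +-*-semiring
  using (sum; sum-syntax; sum-cong-≗; sum-remove; sum-replicate-zero; *-distribˡ-sum; *-distribʳ-sum)
import Algebra.Construct.NaturalChoice.Min as Min
import Algebra.Construct.NaturalChoice.Max as Max

open +-*-Solver

module FinMin {T : ℕ} = Min (≤ᶠ-totalOrder T)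
module FinMax {T : ℕ} = Max (≤ᶠ-totalOrder T)
open FinMin using (_⊓_; x⊓y≤y; ⊓-idem; ⊓-mono-≤; x≤y⇒x⊓y≈x; x≤y⇒y⊓x≈x)
open FinMax using (_⊔_; x≤y⊔x; ⊔-idem; ⊔-mono-≤; x≤y⇒x⊔y≈y; x≤y⇒y⊔x≈y)

-- Over ℤ this is (o - m) * (o - n) ≥ 0.
m≤o⇒n≤o⇒o*[m+n]≤o*o+m*n : ∀ {m n o} → m ≤ o → n ≤ o → o * (m + n) ≤ o * o + m * n
m≤o⇒n≤o⇒o*[m+n]≤o*o+m*n {m} {n} m≤o n≤o with m≤n⇒∃[o]m+o≡n m≤o
... | k , refl = begin
  (m + k) * (m + n)                   ≡⟨ solve 3 (λ m k n → (m :+ k) :* (m :+ n) := ((m :+ k) :* m :+ m :* n) :+ k :* n) refl m k n ⟩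
  ((m + k) * m + m * n) + k * n       ≤⟨ +-monoʳ-≤ ((m + k) * m + m * n) (*-monoʳ-≤ k n≤o) ⟩
  ((m + k) * m + m * n) + k * (m + k) ≡⟨ solve 3 (λ m k n → ((m :+ k) :* m :+ m :* n) :+ k :* (m :+ k) := (m :+ k) :* (m :+ k) :+ m :* n) refl m k n ⟩
  (m + k) * (m + k) + m * n           ∎
  where open ≤-Reasoning

m≤o⇒n≤o⇒m*n≤o*p⇒m+n≤o+p : ∀ {m n o p} → m ≤ o → n ≤ o → m * n ≤ o * p → m + n ≤ o + p
m≤o⇒n≤o⇒m*n≤o*p⇒m+n≤o+p {o = zero} z≤n z≤n _ = z≤n
m≤o⇒n≤o⇒m*n≤o*p⇒m+n≤o+p {m} {n} {o@(suc _)} {p} m≤o n≤o mn≤op = *-cancelˡ-≤ o (begin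
  o * (m + n)   ≤⟨ m≤o⇒n≤o⇒o*[m+n]≤o*o+m*n m≤o n≤o ⟩
  o * o + m * n ≤⟨ +-monoʳ-≤ (o * o) mn≤op ⟩
  o * o + o * p ≡⟨ *-distribˡ-+ o o p ⟨
  o * (o + p)   ∎)
  where open ≤-Reasoning

fourFunctions₂ : ∀ a₀ a₁ b₀ b₁ c₀ c₁ d₀ d₁ →
  a₀ * b₀ ≤ c₀ * d₀ → a₀ * b₁ ≤ c₀ * d₁ → a₁ * b₀ ≤ c₀ * d₁ → a₁ * b₁ ≤ c₁ * d₁ →
  (a₀ + a₁) * (b₀ + b₁) ≤ (c₀ + c₁) * (d₀ + d₁)
fourFunctions₂ a₀ a₁ b₀ b₁ c₀ c₁ d₀ d₁ h₀₀ h₀₁ h₁₀ h₁₁ = begin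
  (a₀ + a₁) * (b₀ + b₁)                         ≡⟨ expand a₀ a₁ b₀ b₁ ⟩
  (a₀ * b₀ + a₁ * b₁) + (a₀ * b₁ + a₁ * b₀)     ≤⟨ +-mono-≤ (+-mono-≤ h₀₀ h₁₁) cross ⟩
  (c₀ * d₀ + c₁ * d₁) + (c₀ * d₁ + c₁ * d₀)     ≡⟨ expand c₀ c₁ d₀ d₁ ⟨
  (c₀ + c₁) * (d₀ + d₁)                         ∎
  where
  open ≤-Reasoning
  expand : ∀ a₀ a₁ b₀ b₁ → (a₀ + a₁) * (b₀ + b₁) ≡ (a₀ * b₀ + a₁ * b₁) + (a₀ * b₁ + a₁ * b₀)
  expand = solve 4 (λ a₀ a₁ b₀ b₁ → (a₀ :+ a₁) :* (b₀ :+ b₁) := (a₀ :* b₀ :+ a₁ :* b₁) :+ (a₀ :* b₁ :+ a₁ :* b₀)) refl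
  swap : ∀ a₀ a₁ b₀ b₁ → (a₀ * b₁) * (a₁ * b₀) ≡ (a₀ * b₀) * (a₁ * b₁)
  swap = solve 4 (λ a₀ a₁ b₀ b₁ → (a₀ :* b₁) :* (a₁ :* b₀) := (a₀ :* b₀) :* (a₁ :* b₁)) refl
  -- each cross term is at most c₀ d₁, and their product is at most that of the diagonal terms
  cross : a₀ * b₁ + a₁ * b₀ ≤ c₀ * d₁ + c₁ * d₀
  cross = m≤o⇒n≤o⇒m*n≤o*p⇒m+n≤o+p h₀₁ h₁₀ (begin
    (a₀ * b₁) * (a₁ * b₀) ≡⟨ swap a₀ a₁ b₀ b₁ ⟩
    (a₀ * b₀) * (a₁ * b₁) ≤⟨ *-mono-≤ h₀₀ h₁₁ ⟩
    (c₀ * d₀) * (c₁ * d₁) ≡⟨ swap c₀ c₁ d₀ d₁ ⟨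
    (c₀ * d₁) * (c₁ * d₀) ∎)

sum-mono-≤ : ∀ {T} {f g : Fin T → ℕ} → (∀ i → f i ≤ g i) → sum f ≤ sum g
sum-mono-≤ {zero}  f≤g = z≤n
sum-mono-≤ {suc T} f≤g = +-mono-≤ (f≤g Fin.zero) (sum-mono-≤ (f≤g ∘ Fin.suc))

*-sum-mono-≤ : ∀ {T} a c {f g : Fin T → ℕ} → (∀ i → a * f i ≤ c * g i) → a * sum f ≤ c * sum g
*-sum-mono-≤ a c {f} {g} h = begin
  a * sum f                ≡⟨ *-distribˡ-sum a f ⟩
  sum (λ i → a * f i)      ≤⟨ sum-mono-≤ h ⟩
  sum (λ i → c * g i)      ≡⟨ *-distribˡ-sum c g ⟨
  c * sum g                ∎
  where open ≤-Reasoning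

sum-*-mono-≤ : ∀ {T} b c {f g : Fin T → ℕ} → (∀ i → f i * b ≤ c * g i) → sum f * b ≤ c * sum g
sum-*-mono-≤ b c {f} {g} h = begin
  sum f * b                ≡⟨ *-distribʳ-sum b f ⟩
  sum (λ i → f i * b)      ≤⟨ sum-mono-≤ h ⟩
  sum (λ i → c * g i)      ≡⟨ *-distribˡ-sum c g ⟨
  c * sum g                ∎
  where open ≤-Reasoning

fourFunctions-chain-≤ : ∀ {T} (α β γ δ : Fin T → ℕ) →
  (∀ {i j} → i ≤ᶠ j → α i * β j ≤ γ i * δ j × α j * β i ≤ γ i * δ j) →
  sum α * sum β ≤ sum γ * sum δ
fourFunctions-chain-≤ {zero}  α β γ δ h = z≤n
fourFunctions-chain-≤ {suc T} α β γ δ h =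
  fourFunctions₂ (α zero) (sum (α ∘ suc)) (β zero) (sum (β ∘ suc))
                 (γ zero) (sum (γ ∘ suc)) (δ zero) (sum (δ ∘ suc))
    (proj₁ (h {j = zero} z≤n))
    (*-sum-mono-≤ (α zero) (γ zero) (λ j → proj₁ (h {j = suc j} z≤n)))
    (sum-*-mono-≤ (β zero) (γ zero) (λ i → proj₂ (h {j = suc i} z≤n)))
    (fourFunctions-chain-≤ (α ∘ suc) (β ∘ suc) (γ ∘ suc) (δ ∘ suc) (h ∘ s≤s))
  where open Data.Fin using (zero; suc)

fourFunctions-chain : ∀ {T} (α β γ δ : Fin T → ℕ) →
  (∀ i j → α i * β j ≤ γ (i ⊓ j) * δ (i ⊔ j)) →
  sum α * sum β ≤ sum γ * sum δ
fourFunctions-chain α β γ δ h = fourFunctions-chain-≤ α β γ δ λ {i} {j} i≤j →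
  subst₂ (λ m M → α i * β j ≤ γ m * δ M) (x≤y⇒x⊓y≈x i≤j) (x≤y⇒x⊔y≈y i≤j) (h i j) ,
  subst₂ (λ m M → α j * β i ≤ γ m * δ M) (x≤y⇒y⊓x≈x i≤j) (x≤y⇒y⊔x≈y i≤j) (h j i)

Map : ℕ → ℕ → Set
Map n T = Fin n → Fin T

_∧_ _∨_ : ∀ {n T} → Map n T → Map n T → Map n T
(f ∧ g) u = f u ⊓ g u
(f ∨ g) u = f u ⊔ g u

∧-∷ : ∀ {n T} (v w : Fin T) (f g : Map n T) → (v ∷ f) ∧ (w ∷ g) ≗ (v ⊓ w) ∷ (f ∧ g)
∧-∷ v w f g Fin.zero    = refl
∧-∷ v w f g (Fin.suc u) = refl

∨-∷ : ∀ {n T} (v w : Fin T) (f g : Map n T) → (v ∷ f) ∨ (w ∷ g) ≗ (v ⊔ w) ∷ (f ∨ g)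
∨-∷ v w f g Fin.zero    = refl
∨-∷ v w f g (Fin.suc u) = refl

∑ᴹ : ∀ n {T} → (Map n T → ℕ) → ℕ
∑ᴹ zero    φ = φ []
∑ᴹ (suc n) {T} φ = ∑[ v < T ] ∑ᴹ n (λ f → φ (v ∷ f))

Extensional : ∀ {n T} → (Map n T → ℕ) → Set
Extensional φ = ∀ {f g} → f ≗ g → φ f ≡ φ g

∷-extensional : ∀ {n T} {φ : Map (suc n) T → ℕ} → Extensional φ → ∀ v → Extensional (λ f → φ (v ∷ f))
∷-extensional φ-ext v f≗g = φ-ext λ { Fin.zero → refl ; (Fin.suc u) → f≗g u }

fourFunctions : ∀ n {T} (α β γ δ : Map n T → ℕ) → Extensional γ → Extensional δ →
  (∀ f g → α f * β g ≤ γ (f ∧ g) * δ (f ∨ g)) →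
  ∑ᴹ n α * ∑ᴹ n β ≤ ∑ᴹ n γ * ∑ᴹ n δ
fourFunctions zero    α β γ δ γ-ext δ-ext h =
  subst₂ (λ m M → α [] * β [] ≤ m * M) (γ-ext λ ()) (δ-ext λ ()) (h [] [])
fourFunctions (suc n) α β γ δ γ-ext δ-ext h = fourFunctions-chain _ _ _ _ λ v w →
  fourFunctions n (λ f → α (v ∷ f)) (λ g → β (w ∷ g))
                  (λ m → γ ((v ⊓ w) ∷ m)) (λ M → δ ((v ⊔ w) ∷ M))
                  (∷-extensional γ-ext (v ⊓ w)) (∷-extensional δ-ext (v ⊔ w))
    λ f g → subst₂ (λ m M → α (v ∷ f) * β (w ∷ g) ≤ m * M)
                   (γ-ext (∧-∷ v w f g)) (δ-ext (∨-∷ v w f g)) (h (v ∷ f) (w ∷ g))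

∑ᴹ-cong : ∀ n {T} {φ ψ : Map n T → ℕ} → (∀ f → φ f ≡ ψ f) → ∑ᴹ n φ ≡ ∑ᴹ n ψ
∑ᴹ-cong zero    φ≗ψ = φ≗ψ []
∑ᴹ-cong (suc n) φ≗ψ = sum-cong-≗ λ v → ∑ᴹ-cong n (λ f → φ≗ψ (v ∷ f))

∑ᴹ-zero : ∀ n {T} {φ : Map n T → ℕ} → (∀ f → φ f ≡ 0) → ∑ᴹ n φ ≡ 0
∑ᴹ-zero zero        φ≗0 = φ≗0 []
∑ᴹ-zero (suc n) {T} φ≗0 =
  trans (sum-cong-≗ λ v → ∑ᴹ-zero n (λ f → φ≗0 (v ∷ f))) (sum-replicate-zero T)

∑ᴹ-punchIn : ∀ n {T} (p : Fin (suc T)) {φ : Map n (suc T) → ℕ} → Extensional φ →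
  (∀ g u → g u ≡ p → φ g ≡ 0) → ∑ᴹ n φ ≡ ∑ᴹ n (λ h → φ (punchIn p ∘ h))
∑ᴹ-punchIn zero        p φ-ext φ-hits = φ-ext (λ ())
∑ᴹ-punchIn (suc n) {T} p {φ} φ-ext φ-hits = begin
  ∑[ v < suc T ] F v                                    ≡⟨ sum-remove {i = p} F ⟩
  F p + ∑[ j < T ] F (punchIn p j)                       ≡⟨ cong₂ _+_ Fp≡0 (sum-cong-≗ F∘punchIn) ⟩
  ∑[ j < T ] ∑ᴹ n (λ h → φ (punchIn p ∘ (j ∷ h)))        ∎
  where
  open ≡-Reasoning
  F : Fin (suc T) → ℕ
  F v = ∑ᴹ n (λ f → φ (v ∷ f))
  Fp≡0 : F p ≡ 0
  Fp≡0 = ∑ᴹ-zero n (λ f → φ-hits (p ∷ f) Fin.zero refl)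
  F∘punchIn : ∀ j → F (punchIn p j) ≡ ∑ᴹ n (λ h → φ (punchIn p ∘ (j ∷ h)))
  F∘punchIn j = trans
    (∑ᴹ-punchIn n p (∷-extensional φ-ext (punchIn p j)) (λ g u → φ-hits (punchIn p j ∷ g) (Fin.suc u)))
    (∑ᴹ-cong n λ h → φ-ext λ { Fin.zero → refl ; (Fin.suc u) → refl })

sumᴸ-tabulate : ∀ {T} (g : Fin T → ℕ) → sumᴸ (tabulate g) ≡ sum g
sumᴸ-tabulate {zero}  g = refl
sumᴸ-tabulate {suc T} g = cong (g Fin.zero +_) (sumᴸ-tabulate (g ∘ Fin.suc))

sumᴸ-map-concatMap : ∀ {A B : Set} (φ : B → ℕ) (K : A → List B) xs →
  sumᴸ (map φ (concatMap K xs)) ≡ sumᴸ (map (λ a → sumᴸ (map φ (K a))) xs)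
sumᴸ-map-concatMap φ K List.[]         = refl
sumᴸ-map-concatMap φ K (a List.∷ xs)   = begin
  sumᴸ (map φ (K a ++ concatMap K xs))                  ≡⟨ cong sumᴸ (map-++ φ (K a) (concatMap K xs)) ⟩
  sumᴸ (map φ (K a) ++ map φ (concatMap K xs))          ≡⟨ sum-++ (map φ (K a)) _ ⟩
  sumᴸ (map φ (K a)) + sumᴸ (map φ (concatMap K xs))    ≡⟨ cong (sumᴸ (map φ (K a)) +_) (sumᴸ-map-concatMap φ K xs) ⟩
  sumᴸ (map (λ a → sumᴸ (map φ (K a))) (a List.∷ xs))  ∎
  where open ≡-Reasoning

∑ᴹ-allMaps : ∀ n {T} {φ : Map n T → ℕ} → Extensional φ → sumᴸ (map φ (allMaps n T)) ≡ ∑ᴹ n φ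
∑ᴹ-allMaps zero            φ-ext = trans (+-identityʳ _) (φ-ext λ ())
∑ᴹ-allMaps (suc n) {T} {φ} φ-ext = unfold _ (λ v f → λ { Fin.zero → refl ; (Fin.suc u) → refl })
  where
  open ≡-Reasoning
  -- allMaps extends by an anonymous pattern lambda; abstracting it as ins lets unification supply it.
  unfold : (ins : Fin T → Map n T → Map (suc n) T) → (∀ v f → ins v f ≗ v ∷ f) →
    sumᴸ (map φ (concatMap (λ v → map (ins v) (allMaps n T)) (allFin T))) ≡ ∑ᴹ (suc n) φ
  unfold ins ins≗∷ = begin
    sumᴸ (map φ (concatMap (λ v → map (ins v) (allMaps n T)) (allFin T)))
      ≡⟨ sumᴸ-map-concatMap φ _ (allFin T) ⟩
    sumᴸ (map (λ v → sumᴸ (map φ (map (ins v) (allMaps n T)))) (allFin T))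
      ≡⟨ trans (cong sumᴸ (map-tabulate (λ v → v) G)) (sumᴸ-tabulate G) ⟩
    ∑[ v < T ] sumᴸ (map φ (map (ins v) (allMaps n T)))
      ≡⟨ sum-cong-≗ (λ v → cong sumᴸ (trans (sym (map-∘ (allMaps n T))) (map-cong (φ-ext ∘ ins≗∷ v) (allMaps n T)))) ⟩
    ∑[ v < T ] sumᴸ (map (λ f → φ (v ∷ f)) (allMaps n T))
      ≡⟨ sum-cong-≗ (λ v → ∑ᴹ-allMaps n (∷-extensional φ-ext v)) ⟩
    ∑ᴹ (suc n) φ
      ∎
    where
    G : Fin T → ℕ
    G v = sumᴸ (map φ (map (ins v) (allMaps n T)))

𝟙 : ∀ {A : Set} → Dec A → ℕ
𝟙 (yes _) = 1
𝟙 (no _)  = 0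

𝟙-cong : ∀ {A B : Set} → A ⇔ B → (a? : Dec A) (b? : Dec B) → 𝟙 a? ≡ 𝟙 b?
𝟙-cong A⇔B (yes _) (yes _) = refl
𝟙-cong A⇔B (yes a) (no ¬b) = contradiction (Equivalence.to A⇔B a) ¬b
𝟙-cong A⇔B (no ¬a) (yes b) = contradiction (Equivalence.from A⇔B b) ¬a
𝟙-cong A⇔B (no _)  (no _)  = refl

𝟙-no : ∀ {A : Set} → ¬ A → (a? : Dec A) → 𝟙 a? ≡ 0
𝟙-no ¬a (yes a) = contradiction a ¬a
𝟙-no ¬a (no _)  = refl

𝟙-*-mono-≤ : ∀ {A B C D : Set} → (A → B → C × D) →
  (a? : Dec A) (b? : Dec B) (c? : Dec C) (d? : Dec D) → 𝟙 a? * 𝟙 b? ≤ 𝟙 c? * 𝟙 d?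
𝟙-*-mono-≤ ab⇒cd (no _)  _       _       _       = z≤n
𝟙-*-mono-≤ ab⇒cd (yes _) (no _)  _       _       = z≤n
𝟙-*-mono-≤ ab⇒cd (yes a) (yes b) (yes _) (yes _) = ≤-refl
𝟙-*-mono-≤ ab⇒cd (yes a) (yes b) (no ¬c) _       = contradiction (proj₁ (ab⇒cd a b)) ¬c
𝟙-*-mono-≤ ab⇒cd (yes a) (yes b) (yes _) (no ¬d) = contradiction (proj₂ (ab⇒cd a b)) ¬d

length-filter≡sum-𝟙 : ∀ {A : Set} {Q : A → Set} (Q? : Decidable Q) xs →
  length (filter Q? xs) ≡ sumᴸ (map (𝟙 ∘ Q?) xs)
length-filter≡sum-𝟙 Q? List.[]         = refl
length-filter≡sum-𝟙 Q? (a List.∷ xs) with Q? a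
... | yes _ = cong suc (length-filter≡sum-𝟙 Q? xs)
... | no _  = length-filter≡sum-𝟙 Q? xs

Respects≗ : ∀ {n T} → (Map n T → Set) → Set
Respects≗ Q = ∀ {f g} → f ≗ g → Q f → Q g

×-respects≗ : ∀ {n T} {Q R : Map n T → Set} → Respects≗ Q → Respects≗ R → Respects≗ (λ g → Q g × R g)
×-respects≗ Q-resp R-resp f≗g (q , r) = Q-resp f≗g q , R-resp f≗g r

𝟙-extensional : ∀ {n T} {Q : Map n T → Set} → Respects≗ Q → (Q? : Decidable Q) → Extensional (𝟙 ∘ Q?)
𝟙-extensional Q-resp Q? {f} {g} f≗g = 𝟙-cong (mk⇔ (Q-resp f≗g) (Q-resp (sym ∘ f≗g))) (Q? f) (Q? g)

∑ᴹ-count : ∀ n {T} {Q : Map n T → Set} → Respects≗ Q → (Q? : Decidable Q) →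
  length (filter Q? (allMaps n T)) ≡ ∑ᴹ n (𝟙 ∘ Q?)
∑ᴹ-count n {T} Q-resp Q? =
  trans (length-filter≡sum-𝟙 Q? (allMaps n T)) (∑ᴹ-allMaps n (𝟙-extensional Q-resp Q?))

Avoids : ∀ {n T} → Fin T → Map n T → Set
Avoids p g = ∀ u → g u ≢ p

avoids? : ∀ {n T} (p : Fin T) → Decidable (Avoids {n} p)
avoids? p g = all? (λ u → ¬? (g u ≟ᶠ p))

avoids-respects≗ : ∀ {n T} (p : Fin T) → Respects≗ (Avoids {n} p)
avoids-respects≗ p f≗g f-avoids u gu≡p = f-avoids u (trans (f≗g u) gu≡p)

∑ᴹ-avoiding : ∀ n {T} (p : Fin (suc T)) {Q : Map n (suc T) → Set} {R : Map n T → Set} →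
  Respects≗ Q → (Q? : Decidable Q) → (R? : Decidable R) → (∀ h → Q (punchIn p ∘ h) ⇔ R h) →
  ∑ᴹ n (λ g → 𝟙 (Q? g ×-dec avoids? p g)) ≡ ∑ᴹ n (𝟙 ∘ R?)
∑ᴹ-avoiding n p {Q} Q-resp Q? R? Q⇔R =
  trans (∑ᴹ-punchIn n p (𝟙-extensional (×-respects≗ Q-resp (avoids-respects≗ p)) (λ g → Q? g ×-dec avoids? p g))
                        (λ g u gu≡p → 𝟙-no (λ (_ , g-avoids) → g-avoids u gu≡p) _))
        (∑ᴹ-cong n λ h → 𝟙-cong (mk⇔ (Equivalence.to (Q⇔R h) ∘ proj₁)
                                     (λ r → Equivalence.from (Q⇔R h) r , λ u → punchInᵢ≢i p (h u)))
                                _ (R? h))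

avoids-fromℕ-∧ : ∀ {n T} {f g : Map n (suc T)} → Avoids (fromℕ T) g → Avoids (fromℕ T) (f ∧ g)
avoids-fromℕ-∧ {f = f} {g} g-avoids u fu⊓gu≡top =
  g-avoids u (≤ᶠ-antisym (≤fromℕ (g u)) (subst (_≤ᶠ g u) fu⊓gu≡top (x⊓y≤y (f u) (g u))))

avoids-zero-∨ : ∀ {n T} {f g : Map n (suc T)} → Avoids Fin.zero g → Avoids Fin.zero (f ∨ g)
avoids-zero-∨ {f = f} {g} g-avoids u fu⊔gu≡0 =
  g-avoids u (≤ᶠ-antisym (subst (g u ≤ᶠ_) fu⊔gu≡0 (x≤y⊔x (f u) (g u))) z≤n)

avoids-suc : ∀ {n T} (p : Fin T) (h : Map n T) → Avoids (Fin.suc p) (Fin.suc ∘ h) ⇔ Avoids p h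
avoids-suc p h = mk⇔ (λ sh-avoids u hu≡p → sh-avoids u (cong Fin.suc hu≡p))
                     (λ h-avoids u shu≡sp → h-avoids u (sucᶠ-injective shu≡sp))

toℕ-punchIn-fromℕ : ∀ {T} (j : Fin T) → toℕ (punchIn (fromℕ T) j) ≡ toℕ j
toℕ-punchIn-fromℕ Fin.zero    = refl
toℕ-punchIn-fromℕ (Fin.suc j) = cong suc (toℕ-punchIn-fromℕ j)

module _ {n} (P : FinPoset n) where

  orderPreserving-respects≗ : ∀ {T} → Respects≗ (OrderPreserving {t = T} P)
  orderPreserving-respects≗ f≗g f-mono u v u≺v = subst₂ _≤ᶠ_ (f≗g u) (f≗g v) (f-mono u v u≺v)

  orderPreserving-∧ : ∀ {T} {f g : Map n T} → OrderPreserving P f → OrderPreserving P g → OrderPreserving P (f ∧ g)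
  orderPreserving-∧ f-mono g-mono u v u≺v = ⊓-mono-≤ (f-mono u v u≺v) (g-mono u v u≺v)

  orderPreserving-∨ : ∀ {T} {f g : Map n T} → OrderPreserving P f → OrderPreserving P g → OrderPreserving P (f ∨ g)
  orderPreserving-∨ f-mono g-mono u v u≺v = ⊔-mono-≤ (f-mono u v u≺v) (g-mono u v u≺v)

  orderPreserving-punchIn : ∀ {T} (p : Fin (suc T)) (h : Map n T) →
    OrderPreserving P (punchIn p ∘ h) ⇔ OrderPreserving P h
  orderPreserving-punchIn p h =
    mk⇔ (λ ph-mono u v u≺v → punchIn-cancel-≤ p (h u) (h v) (ph-mono u v u≺v))
        (λ h-mono u v u≺v → punchIn-mono-≤ p (h u) (h v) (h-mono u v u≺v))

  module _ (x : Fin n) where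

    Counted : ∀ {T} → ℕ → Map n T → Set
    Counted c g = OrderPreserving P g × suc (toℕ (g x)) ≡ c

    counted? : ∀ {T} c → Decidable (Counted {T} c)
    counted? c g = orderPreserving? P g ×-dec (suc (toℕ (g x)) ≟ c)

    counted-respects≗ : ∀ {T} c → Respects≗ (Counted {T} c)
    counted-respects≗ c f≗g (f-mono , fx) =
      orderPreserving-respects≗ f≗g f-mono , trans (cong (suc ∘ toℕ) (sym (f≗g x))) fx

    counted-∧-∨ : ∀ {T c} {f g : Map n T} → Counted c f → Counted c g → Counted c (f ∧ g) × Counted c (f ∨ g)
    counted-∧-∨ {f = f} {g} (f-mono , fx) (g-mono , gx) =
      (orderPreserving-∧ f-mono g-mono , subst (λ y → suc (toℕ y) ≡ _) (sym ⊓-diag) gx) ,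
      (orderPreserving-∨ f-mono g-mono , subst (λ y → suc (toℕ y) ≡ _) (sym ⊔-diag) gx)
      where
      fx≡gx : f x ≡ g x
      fx≡gx = toℕ-injective (suc-injective (trans fx (sym gx)))
      ⊓-diag : f x ⊓ g x ≡ g x
      ⊓-diag = trans (cong (_⊓ g x) fx≡gx) (⊓-idem (g x))
      ⊔-diag : f x ⊔ g x ≡ g x
      ⊔-diag = trans (cong (_⊔ g x) fx≡gx) (⊔-idem (g x))

    counted-punchIn-fromℕ : ∀ {T c} (h : Map n T) → Counted c (punchIn (fromℕ T) ∘ h) ⇔ Counted c h
    counted-punchIn-fromℕ h =
      mk⇔ (λ (ph-mono , phx) → Equivalence.to (orderPreserving-punchIn _ h) ph-mono ,
                                trans (cong suc (sym (toℕ-punchIn-fromℕ (h x)))) phx)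
          (λ (h-mono , hx) → Equivalence.from (orderPreserving-punchIn _ h) h-mono ,
                              trans (cong suc (toℕ-punchIn-fromℕ (h x))) hx)

    counted-punchIn-zero : ∀ {T c} (h : Map n T) → Counted (suc c) (punchIn Fin.zero ∘ h) ⇔ Counted c h
    counted-punchIn-zero h =
      mk⇔ (λ (ph-mono , phx) → Equivalence.to (orderPreserving-punchIn Fin.zero h) ph-mono , suc-injective phx)
          (λ (h-mono , hx) → Equivalence.from (orderPreserving-punchIn Fin.zero h) h-mono , cong suc hx)

    Ω≡∑ᴹ : ∀ {T} c → Ω P T x c ≡ ∑ᴹ n (𝟙 ∘ counted? {T} c)
    Ω≡∑ᴹ c = ∑ᴹ-count n (counted-respects≗ c) (counted? c)

    module _ (t a : ℕ) where

      top : Fin (suc (suc t))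
      top = fromℕ (suc t)

      all belowTop aboveBottom interior : Map n (suc (suc t)) → ℕ
      all         g = 𝟙 (counted? (suc a) g)
      belowTop    g = 𝟙 (counted? (suc a) g ×-dec avoids? top g)
      aboveBottom g = 𝟙 (counted? (suc a) g ×-dec avoids? Fin.zero g)
      interior    g = 𝟙 ((counted? (suc a) g ×-dec avoids? top g) ×-dec avoids? Fin.zero g)

      all*interior≤belowTop*aboveBottom : ∀ f g → all f * interior g ≤ belowTop (f ∧ g) * aboveBottom (f ∨ g)
      all*interior≤belowTop*aboveBottom f g = 𝟙-*-mono-≤
        (λ f-counted ((g-counted , g-avoids-top) , g-avoids-zero) →
          let f∧g-counted , f∨g-counted = counted-∧-∨ f-counted g-counted in
          (f∧g-counted , avoids-fromℕ-∧ {f = f} g-avoids-top) , (f∨g-counted , avoids-zero-∨ {f = f} g-avoids-zero))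
        (counted? (suc a) f) ((counted? (suc a) g ×-dec avoids? top g) ×-dec avoids? Fin.zero g)
        (counted? (suc a) (f ∧ g) ×-dec avoids? top (f ∧ g))
        (counted? (suc a) (f ∨ g) ×-dec avoids? Fin.zero (f ∨ g))

      ∑ᴹ-belowTop : ∑ᴹ n belowTop ≡ Ω P (suc t) x (suc a)
      ∑ᴹ-belowTop = trans
        (∑ᴹ-avoiding n top (counted-respects≗ (suc a)) (counted? (suc a)) (counted? (suc a)) counted-punchIn-fromℕ)
        (sym (Ω≡∑ᴹ (suc a)))

      ∑ᴹ-aboveBottom : ∑ᴹ n aboveBottom ≡ Ω P (suc t) x a
      ∑ᴹ-aboveBottom = trans
        (∑ᴹ-avoiding n Fin.zero (counted-respects≗ (suc a)) (counted? (suc a)) (counted? a) counted-punchIn-zero)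
        (sym (Ω≡∑ᴹ a))

      ∑ᴹ-interior : ∑ᴹ n interior ≡ Ω P t x a
      ∑ᴹ-interior = begin
        ∑ᴹ n interior
          ≡⟨ ∑ᴹ-avoiding n Fin.zero (×-respects≗ (counted-respects≗ (suc a)) (avoids-respects≗ top))
               (λ g → counted? (suc a) g ×-dec avoids? top g) (λ h → counted? a h ×-dec avoids? (fromℕ t) h)
               (λ h → counted-punchIn-zero h ×-⇔ avoids-suc (fromℕ t) h) ⟩
        ∑ᴹ n (λ h → 𝟙 (counted? a h ×-dec avoids? (fromℕ t) h))
          ≡⟨ ∑ᴹ-avoiding n (fromℕ t) (counted-respects≗ a) (counted? a) (counted? a) counted-punchIn-fromℕ ⟩
        ∑ᴹ n (𝟙 ∘ counted? a)
          ≡⟨ Ω≡∑ᴹ a ⟨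
        Ω P t x a
          ∎
        where open ≡-Reasoning

      Ω-shift-≤ : Ω P (suc (suc t)) x (suc a) * Ω P t x a ≤ Ω P (suc t) x (suc a) * Ω P (suc t) x a
      Ω-shift-≤ = begin
        Ω P (suc (suc t)) x (suc a) * Ω P t x a  ≡⟨ cong₂ _*_ (Ω≡∑ᴹ (suc a)) (sym ∑ᴹ-interior) ⟩
        ∑ᴹ n all * ∑ᴹ n interior                 ≤⟨ fourFunctions n all interior belowTop aboveBottom
                                                      (𝟙-extensional (×-respects≗ (counted-respects≗ (suc a)) (avoids-respects≗ top)) _)
                                                      (𝟙-extensional (×-respects≗ (counted-respects≗ (suc a)) (avoids-respects≗ Fin.zero)) _)
                                                      all*interior≤belowTop*aboveBottom ⟩
        ∑ᴹ n belowTop * ∑ᴹ n aboveBottom         ≡⟨ cong₂ _*_ ∑ᴹ-belowTop ∑ᴹ-aboveBottom ⟩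
        Ω P (suc t) x (suc a) * Ω P (suc t) x a  ∎
        where open ≤-Reasoning

theorem4p21 : ∀ {n} (P : FinPoset n) (x : Fin n) (t a : ℕ) → 1 < a → a < t →
    Ω P t x (suc a) * Ω P t x a ≥ Ω P (suc t) x (suc a) * Ω P (t ∸ 1) x a
theorem4p21 P x zero    a _ ()
theorem4p21 P x (suc t) a _ _ = Ω-shift-≤ P x t a
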